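{- Let $S$ be a finite left regular band with identity, $L$ its support lattice, and $k$ an arbitrary field. For each $X\in L$ fix $x\in S$ with $\operatorname{supp}(x)=X$, and define elements of $kS$ recursively (from the top of $L$ downward) by $e_X=x-\sum_{Y>X}xe_Y$. Then $\{e_X\}_{X\in L}$ is a complete system of primitive orthogonal idempotents in $kS$.
   Context: A left regular band is a semigroup $S$ with $x^2=x$ and $xyx=xy$ for all $x,y\in S$. Define the preorder $y\preceq x$ iff $xy=x$; identifying $x,y$ when $x\preceq y\preceq x$ gives a poset $L$ (a finite lattice when $S$ is finite with identity), the support lattice, with quotient map $\operatorname{supp}:S\to L$ satisfying $\operatorname{supp}(xy)=\operatorname{supp}(x)\vee\operatorname{supp}(y)$ and $xy=x$ iff $\operatorname{supp}(y)\le\operatorname{supp}(x)$. A complete system of primitive orthogonal idempotents is a family of primitive idempotents $e_i$ with $e_ie_j=0$ for $i\ne j$ and $\sum_ie_i=1$; an idempotent is primitive if it is not a sum of two nonzero orthogonal idempotents. -}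

module Defs where

open import Level using (Level; _⊔_)
open import Algebra.Bundles using (CommutativeRing)
open import Data.Nat using (ℕ; zero; suc)
open import Data.Fin using (Fin)
open import Data.Fin.Properties using (_≟_)
open import Data.Product using (Σ; _×_; _,_)
open import Relation.Nullary using (¬_; Dec; yes; no)
open import Relation.Nullary.Decidable using (_×-dec_; ¬?)
open import Relation.Binary.PropositionalEquality using (_≡_; _≢_)

record IsField {c ℓ : Level} (K : CommutativeRing c ℓ) : Set (c ⊔ ℓ) where
  open CommutativeRing K
  field
    1≉0     : ¬ (1# ≈ 0#)
    inverse : ∀ x → ¬ (x ≈ 0#) → Σ Carrier (λ y → x * y ≈ 1#)

record FiniteLRBMonoid : Set where
  field
    n       : ℕ
    _·_     : Fin n → Fin n → Fin n
    ·-assoc : ∀ x y z → (x · y) · z ≡ x · (y · z)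
    ·-idem  : ∀ x → x · x ≡ x
    ·-lrb   : ∀ x y → (x · y) · x ≡ x · y
    one     : Fin n
    one-l   : ∀ x → one · x ≡ x
    one-r   : ∀ x → x · one ≡ x

module _ (S : FiniteLRBMonoid) where
  open FiniteLRBMonoid S

  -- y ⪯ x iff x y = x, i.e. supp y ≤ supp x.
  _⪯_ : Fin n → Fin n → Set
  y ⪯ x = x · y ≡ x

  _⪯?_ : ∀ y x → Dec (y ⪯ x)
  y ⪯? x = (x · y) ≟ x

  SameSupp : Fin n → Fin n → Set
  SameSupp x y = (x ⪯ y) × (y ⪯ x)

  _≺_ : Fin n → Fin n → Set
  x ≺ y = (x ⪯ y) × ¬ (y ⪯ x)

  _≺?_ : ∀ x y → Dec (x ≺ y)
  x ≺? y = (x ⪯? y) ×-dec ¬? (y ⪯? x)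

  -- A choice, for each X ∈ L, of an element x ∈ S with supp x = X,
  -- encoded as a map rep : S → S which is constant on support classes
  -- and sends s to an element of the same support as s.
  -- The support lattice L is then in bijection with the fixed points
  -- of rep (the chosen representatives).
  record SuppChoice : Set where
    field
      rep      : Fin n → Fin n
      rep-supp : ∀ s → SameSupp (rep s) s
      rep-cong : ∀ s t → SameSupp s t → rep s ≡ rep t

module Algebra {c ℓ : Level} (K : CommutativeRing c ℓ) (S : FiniteLRBMonoid) where
  open CommutativeRing K
  open FiniteLRBMonoid S

  Σ[_] : ∀ {m} → (Fin m → Carrier) → Carrier
  Σ[_] {zero}  f = 0#
  Σ[_] {suc m} f = f Fin.zero + Σ[_] {m} (λ i → f (Fin.suc i))

  kS : Set c
  kS = Fin n → Carrier

  _≈S_ : kS → kS → Set ℓ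
  a ≈S b = ∀ s → a s ≈ b s

  0S : kS
  0S _ = 0#

  ⟦_⟧ : Fin n → kS
  ⟦ x ⟧ s with s ≟ x
  ... | yes _ = 1#
  ... | no  _ = 0#

  1S : kS
  1S = ⟦ one ⟧

  _+S_ : kS → kS → kS
  (a +S b) s = a s + b s

  -S_ : kS → kS
  (-S a) s = - (a s)

  _-S_ : kS → kS → kS
  a -S b = a +S (-S b)

  _⋆_ : kS → kS → kS
  (a ⋆ b) s = Σ[ (λ t → Σ[ (λ u → δ t u) ]) ]
    where
      δ : Fin n → Fin n → Carrier
      δ t u with (t · u) ≟ s
      ... | yes _ = a t * b u
      ... | no  _ = 0#

  ΣS : ∀ {m} → (Fin m → kS) → kS
  ΣS f s = Σ[ (λ i → f i s) ]

  when : ∀ {p} {P : Set p} → Dec P → kS → kS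
  when (yes _) a = a
  when (no _)  a = 0S

  IsIdempotent : kS → Set ℓ
  IsIdempotent e = (e ⋆ e) ≈S e

  Orthogonal : kS → kS → Set ℓ
  Orthogonal a b = ((a ⋆ b) ≈S 0S) × ((b ⋆ a) ≈S 0S)

  IsPrimitive : kS → Set (c ⊔ ℓ)
  IsPrimitive e = IsIdempotent e ×
    ¬ (Σ kS (λ a → Σ kS (λ b →
         IsIdempotent a × IsIdempotent b × Orthogonal a b ×
         ¬ (a ≈S 0S) × ¬ (b ≈S 0S) × (e ≈S (a +S b)))))

  module _ (C : SuppChoice S) where
    open SuppChoice C

    -- X ∈ L is represented by its chosen element x (rep x ≡ x).
    IsRep : Fin n → Set
    IsRep x = rep x ≡ x

    isRep? : ∀ x → Dec (IsRep x)
    isRep? x = rep x ≟ x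

    -- A strict chain in L has length < n, so n + 1 rounds of
    -- the recursion suffice; eFuel k x is the value after k rounds.
    eFuel : ℕ → Fin n → kS
    eFuel zero    x = ⟦ x ⟧
    eFuel (suc k) x =
      ⟦ x ⟧ -S ΣS (λ y → when (isRep? y ×-dec (_≺?_ S x y)) (⟦ x ⟧ ⋆ eFuel k y))

    e : Fin n → kS
    e = eFuel (suc n)

{-# OPTIONS --safe #-}
module Submission where

-- Everything is linear, so identities in kS reduce to basis elements.  For every w ∈ S the
-- recursion gives directly w = Σ_{Y ≥ supp w} w e_Y.  From this, downward induction on X shows
-- s e_X = 0 unless supp s ≤ X (the paper's Lemma 4.1); as e_X is supported on {t : supp t ≥ X},
-- it follows that e_X e_Y = 0 unless X ≤ Y.  A second downward induction through the recursion
-- gives e_X e_Y = 0 for X < Y, and then e_X = e_X Σ_Y e_Y = e_X², where Σ_Y e_Y = 1 is the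
-- decomposition of w = 1.  Finally e_X t e_X is e_X or 0 according as supp t ≤ X or not, so
-- e_X kS e_X = k e_X, which forces e_X to be primitive over a field.

open import Defs
open import Level using (Level; _⊔_)
open import Algebra.Bundles using (CommutativeRing)
open import Data.Bool.Properties using (T-≡)
open import Data.Fin using (Fin; zero; suc; punchIn)
open import Data.Fin.Induction using (spo-noetherian)
open import Data.Fin.Properties using (_≟_; punchInᵢ≢i)
open import Data.Fin.Subset using (Subset; _∈_; ∣_∣)
open import Data.Fin.Subset.Properties using (∣p∣≤n; p⊂q⇒∣p∣<∣q∣)
open import Data.Nat using (ℕ; zero; suc; _≤_; _<_)
open import Data.Nat.Properties using (≤-pred; <-≤-trans; n≮0)
open import Data.Product using (Σ; _×_; _,_; proj₁; proj₂)
open import Data.Sum using (_⊎_; inj₁; inj₂)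
open import Data.Vec using (tabulate)
open import Data.Vec.Properties using (lookup∘tabulate; lookup⇒[]=; []=⇒lookup)
open import Function using (_∘_; flip; Equivalence)
open import Induction.WellFounded using (WellFounded; WfRec; module All)
open import Relation.Binary.Bundles using (Setoid)
open import Relation.Binary.PropositionalEquality as ≡ using (_≡_; _≢_)
import Relation.Binary.Reasoning.Setoid as SetoidReasoning
open import Relation.Nullary using (¬_; Dec; yes; no; contradiction)
open import Relation.Nullary.Decidable using (_×-dec_; isYes; toWitness; fromWitness)
open import Relation.Unary using (Pred; Decidable)

module SupportOrder (S : FiniteLRBMonoid) where
  open FiniteLRBMonoid S

  infix 4 _⊑_ _⊏_

  _⊑_ : Fin n → Fin n → Set
  _⊑_ = _⪯_ S

  _⊏_ : Fin n → Fin n → Set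
  _⊏_ = _≺_ S

  ⊑-refl : ∀ x → x ⊑ x
  ⊑-refl = ·-idem

  ⊑-trans : ∀ {x y z} → x ⊑ y → y ⊑ z → x ⊑ z
  ⊑-trans {x} {y} {z} x⊑y y⊑z = begin
    z · x        ≡⟨ ≡.cong (_· x) y⊑z ⟨
    (z · y) · x  ≡⟨ ·-assoc z y x ⟩
    z · (y · x)  ≡⟨ ≡.cong (z ·_) x⊑y ⟩
    z · y        ≡⟨ y⊑z ⟩
    z            ∎
    where open ≡.≡-Reasoning

  ⊑-·ˡ : ∀ x y → x ⊑ x · y
  ⊑-·ˡ = ·-lrb

  ⊑-·ʳ : ∀ x y → y ⊑ x · y
  ⊑-·ʳ x y = ≡.trans (·-assoc x y y) (≡.cong (x ·_) (·-idem y))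

  ⊏-irrefl : ∀ {x} → ¬ x ⊏ x
  ⊏-irrefl {x} (_ , x⋢x) = x⋢x (⊑-refl x)

  ⊏-⊑-trans : ∀ {x y z} → x ⊏ y → y ⊑ z → x ⊏ z
  ⊏-⊑-trans (x⊑y , y⋢x) y⊑z = ⊑-trans x⊑y y⊑z , λ z⊑x → y⋢x (⊑-trans y⊑z z⊑x)

  ⊏-trans : ∀ {x y z} → x ⊏ y → y ⊏ z → x ⊏ z
  ⊏-trans x⊏y (y⊑z , _) = ⊏-⊑-trans x⊏y y⊑z

  ⊏-· : ∀ {s x} → ¬ s ⊑ x → x ⊏ s · x
  ⊏-· {s} {x} s⋢x = ⊑-·ʳ s x , λ sx⊑x → s⋢x (⊑-trans (⊑-·ˡ s x) sx⊑x)

  ⊏-noetherian : WellFounded (flip _⊏_)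
  ⊏-noetherian = spo-noetherian record
    { isEquivalence = ≡.isEquivalence
    ; irrefl        = λ { ≡.refl → ⊏-irrefl }
    ; trans         = ⊏-trans
    ; <-resp-≈      = ≡.resp₂ _⊏_
    }

  strictUpperSet : Fin n → Subset n
  strictUpperSet x = tabulate (λ y → isYes (_≺?_ S x y))

  ∈-strictUpperSet : ∀ {x y} → x ⊏ y → y ∈ strictUpperSet x
  ∈-strictUpperSet {x} {y} x⊏y = lookup⇒[]= y _
    (≡.trans (lookup∘tabulate _ y) (Equivalence.to T-≡ (fromWitness {a? = _≺?_ S x y} x⊏y)))

  strictUpperSet-⊏ : ∀ {x y} → y ∈ strictUpperSet x → x ⊏ y
  strictUpperSet-⊏ {x} {y} y∈ = toWitness {a? = _≺?_ S x y}
    (Equivalence.from T-≡ (≡.trans (≡.sym (lookup∘tabulate _ y)) ([]=⇒lookup y∈)))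

  height : Fin n → ℕ
  height x = ∣ strictUpperSet x ∣

  height≤n : ∀ x → height x ≤ n
  height≤n x = ∣p∣≤n (strictUpperSet x)

  height-< : ∀ {x y} → x ⊏ y → height y < height x
  height-< {x} {y} x⊏y = p⊂q⇒∣p∣<∣q∣
    ( (λ z∈ → ∈-strictUpperSet (⊏-trans x⊏y (strictUpperSet-⊏ z∈)))
    , y , ∈-strictUpperSet x⊏y , ⊏-irrefl ∘ strictUpperSet-⊏ )

module MonoidAlgebra {c ℓ : Level} (K : CommutativeRing c ℓ) (S : FiniteLRBMonoid) where
  open CommutativeRing K hiding (zero)
  open FiniteLRBMonoid S
  open Algebra K S
  open SupportOrder S
  open import Algebra.Properties.CommutativeMonoid.Sum +-commutativeMonoid
    using (sum; sum-cong-≋; sum-replicate-zero; sum-remove; ∑-distrib-+; ∑-comm)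
  open import Algebra.Properties.Semiring.Sum semiring using (*-distribˡ-sum; *-distribʳ-sum)
  open import Algebra.Properties.Ring ring using (-1*x≈-x; -0#≈0#)
  open import Algebra.Properties.CommutativeSemigroup *-commutativeSemigroup using (x∙yz≈y∙xz)
  open import Data.Vec.Functional.Relation.Binary.Equality.Setoid setoid using (≋-setoid)

  Σ≡sum : ∀ {m} (f : Fin m → Carrier) → Σ[ f ] ≡ sum f
  Σ≡sum {zero}  f = ≡.refl
  Σ≡sum {suc m} f = ≡.cong (f zero +_) (Σ≡sum (f ∘ suc))

  module _ {m : ℕ} where
    open SetoidReasoning setoid

    Σ-cong : {f g : Fin m → Carrier} → (∀ i → f i ≈ g i) → Σ[ f ] ≈ Σ[ g ]
    Σ-cong {f} {g} f≈g = begin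
      Σ[ f ]  ≡⟨ Σ≡sum f ⟩
      sum f   ≈⟨ sum-cong-≋ f≈g ⟩
      sum g   ≡⟨ Σ≡sum g ⟨
      Σ[ g ]  ∎

    Σ-zero : {f : Fin m → Carrier} → (∀ i → f i ≈ 0#) → Σ[ f ] ≈ 0#
    Σ-zero {f} f≈0 = begin
      Σ[ f ]              ≡⟨ Σ≡sum f ⟩
      sum f               ≈⟨ sum-cong-≋ f≈0 ⟩
      sum {m} (λ _ → 0#)  ≈⟨ sum-replicate-zero m ⟩
      0#                  ∎

    Σ-distrib-+ : (f g : Fin m → Carrier) → Σ[ (λ i → f i + g i) ] ≈ Σ[ f ] + Σ[ g ]
    Σ-distrib-+ f g = begin
      Σ[ (λ i → f i + g i) ]  ≡⟨ Σ≡sum (λ i → f i + g i) ⟩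
      sum (λ i → f i + g i)   ≈⟨ ∑-distrib-+ f g ⟩
      sum f + sum g           ≡⟨ ≡.cong₂ _+_ (Σ≡sum f) (Σ≡sum g) ⟨
      Σ[ f ] + Σ[ g ]         ∎

    *-distribˡ-Σ : ∀ r (f : Fin m → Carrier) → r * Σ[ f ] ≈ Σ[ (λ i → r * f i) ]
    *-distribˡ-Σ r f = begin
      r * Σ[ f ]             ≡⟨ ≡.cong (r *_) (Σ≡sum f) ⟩
      r * sum f              ≈⟨ *-distribˡ-sum r f ⟩
      sum (λ i → r * f i)    ≡⟨ Σ≡sum (λ i → r * f i) ⟨
      Σ[ (λ i → r * f i) ]  ∎

    *-distribʳ-Σ : ∀ r (f : Fin m → Carrier) → Σ[ f ] * r ≈ Σ[ (λ i → f i * r) ]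
    *-distribʳ-Σ r f = begin
      Σ[ f ] * r             ≡⟨ ≡.cong (_* r) (Σ≡sum f) ⟩
      sum f * r              ≈⟨ *-distribʳ-sum r f ⟩
      sum (λ i → f i * r)    ≡⟨ Σ≡sum (λ i → f i * r) ⟨
      Σ[ (λ i → f i * r) ]  ∎

    Σ-comm : ∀ {k} (f : Fin m → Fin k → Carrier) →
             Σ[ (λ i → Σ[ f i ]) ] ≈ Σ[ (λ j → Σ[ (λ i → f i j) ]) ]
    Σ-comm f = begin
      Σ[ (λ i → Σ[ f i ]) ]            ≈⟨ Σ≈sum² f ⟩
      sum (λ i → sum (f i))            ≈⟨ ∑-comm f ⟩
      sum (λ j → sum (λ i → f i j))    ≈⟨ Σ≈sum² (λ j i → f i j) ⟨
      Σ[ (λ j → Σ[ (λ i → f i j) ]) ]  ∎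
      where
      Σ≈sum² : ∀ {a b} (g : Fin a → Fin b → Carrier) → Σ[ (λ i → Σ[ g i ]) ] ≈ sum (λ i → sum (g i))
      Σ≈sum² g = trans (reflexive (Σ≡sum (λ i → Σ[ g i ])))
                       (sum-cong-≋ (λ i → reflexive (Σ≡sum (g i))))

  Σ-single : ∀ {m} {f : Fin m → Carrier} (j : Fin m) → (∀ i → i ≢ j → f i ≈ 0#) → Σ[ f ] ≈ f j
  Σ-single {suc m} {f} j f≈0 = begin
    Σ[ f ]                     ≡⟨ Σ≡sum f ⟩
    sum f                      ≈⟨ sum-remove f ⟩
    f j + sum (f ∘ punchIn j)  ≈⟨ +-congˡ (sum-cong-≋ (λ i → f≈0 _ (punchInᵢ≢i j i))) ⟩
    f j + sum {m} (λ _ → 0#)   ≈⟨ +-congˡ (sum-replicate-zero m) ⟩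
    f j + 0#                   ≈⟨ +-identityʳ (f j) ⟩
    f j                        ∎
    where open SetoidReasoning setoid

  kS-setoid : Setoid c ℓ
  kS-setoid = record
    { Carrier = kS ; _≈_ = _≈S_ ; isEquivalence = Setoid.isEquivalence (≋-setoid n) }

  open Setoid kS-setoid public using ()
    renaming (refl to ≈S-refl; sym to ≈S-sym; trans to ≈S-trans; reflexive to ≈S-reflexive)

  ΣS-cong : ∀ {m} {f g : Fin m → kS} → (∀ i → f i ≈S g i) → ΣS f ≈S ΣS g
  ΣS-cong f≈g s = Σ-cong (λ i → f≈g i s)

  ΣS-zero : ∀ {m} {f : Fin m → kS} → (∀ i → f i ≈S 0S) → ΣS f ≈S 0S
  ΣS-zero f≈0 s = Σ-zero (λ i → f≈0 i s)

  -S-cong : ∀ {a a′ b b′} → a ≈S a′ → b ≈S b′ → (a -S b) ≈S (a′ -S b′)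
  -S-cong a≈a′ b≈b′ s = +-cong (a≈a′ s) (-‿cong (b≈b′ s))

  -S-congˡ : ∀ a {b b′} → b ≈S b′ → (a -S b) ≈S (a -S b′)
  -S-congˡ a = -S-cong (≈S-refl {a})

  -S-inverseʳ : ∀ a → (a -S a) ≈S 0S
  -S-inverseʳ a s = -‿inverseʳ (a s)

  -S-identityʳ : ∀ a → (a -S 0S) ≈S a
  -S-identityʳ a s = trans (+-congˡ -0#≈0#) (+-identityʳ (a s))

  -S-+S-cancel : ∀ a b → a ≈S ((a -S b) +S b)
  -S-+S-cancel a b s = sym (begin
    (a s + - b s) + b s    ≈⟨ +-assoc (a s) (- b s) (b s) ⟩
    a s + (- b s + b s)    ≈⟨ +-congˡ (-‿inverseˡ (b s)) ⟩
    a s + 0#               ≈⟨ +-identityʳ (a s) ⟩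
    a s                    ∎)
    where open SetoidReasoning setoid

  infixr 7 _•_

  _•_ : Carrier → kS → kS
  (r • a) s = r * a s

  •-congˡ : ∀ r {a b} → a ≈S b → (r • a) ≈S (r • b)
  •-congˡ r a≈b s = *-congˡ (a≈b s)

  •-zeroˡ : ∀ {r} a → r ≈ 0# → (r • a) ≈S 0S
  •-zeroˡ a r≈0 s = trans (*-congʳ r≈0) (zeroˡ (a s))

  •-zeroʳ : ∀ r → (r • 0S) ≈S 0S
  •-zeroʳ r s = zeroʳ r

  •-identityˡ : ∀ a → (1# • a) ≈S a
  •-identityˡ a s = *-identityˡ (a s)

  •-assoc : ∀ r r′ a → (r • (r′ • a)) ≈S ((r * r′) • a)
  •-assoc r r′ a s = sym (*-assoc r r′ (a s))

  ΣS-• : ∀ {m} (r : Fin m → Carrier) a → ΣS (λ i → r i • a) ≈S (Σ[ r ] • a)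
  ΣS-• r a s = sym (*-distribʳ-Σ (a s) r)

  ⟦⟧-diag : ∀ x → ⟦ x ⟧ x ≈ 1#
  ⟦⟧-diag x with x ≟ x
  ... | yes _   = refl
  ... | no  x≢x = contradiction ≡.refl x≢x

  ⟦⟧-off : ∀ {x s} → x ≢ s → ⟦ x ⟧ s ≈ 0#
  ⟦⟧-off {x} {s} x≢s with s ≟ x
  ... | yes s≡x = contradiction (≡.sym s≡x) x≢s
  ... | no  _   = refl

  ⟦⟧-hit : ∀ {x s} → x ≡ s → ⟦ x ⟧ s ≈ 1#
  ⟦⟧-hit {x} ≡.refl = ⟦⟧-diag x

  Σ-siftˡ : ∀ x (f : Fin n → Carrier) → Σ[ (λ t → ⟦ x ⟧ t * f t) ] ≈ f x
  Σ-siftˡ x f =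
    trans (Σ-single x (λ t t≢x → trans (*-congʳ (⟦⟧-off (t≢x ∘ ≡.sym))) (zeroˡ (f t))))
          (trans (*-congʳ (⟦⟧-diag x)) (*-identityˡ (f x)))

  Σ-siftʳ : ∀ (f : Fin n → Carrier) s → Σ[ (λ t → f t * ⟦ t ⟧ s) ] ≈ f s
  Σ-siftʳ f s =
    trans (Σ-single s (λ t t≢s → trans (*-congˡ (⟦⟧-off t≢s)) (zeroʳ (f t))))
          (trans (*-congˡ (⟦⟧-diag s)) (*-identityʳ (f s)))

  basis-expansion : ∀ a → a ≈S ΣS (λ t → a t • ⟦ t ⟧)
  basis-expansion a s = sym (Σ-siftʳ a s)

  module _ (a b : kS) (s : Fin n) where
    private
      -- The left-hand side is the anonymous summand in the definition of _⋆_.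
      summand : ∀ t u → _ ≈ a t * (b u * ⟦ t · u ⟧ s)

    ⋆-kernel : (a ⋆ b) s ≈ Σ[ (λ t → Σ[ (λ u → a t * (b u * ⟦ t · u ⟧ s)) ]) ]
    ⋆-kernel = Σ-cong (λ t → Σ-cong (summand t))

    summand t u with t · u ≟ s
    ... | yes tu≡s = sym (*-congˡ (trans (*-congˡ (⟦⟧-hit tu≡s)) (*-identityʳ (b u))))
    ... | no  tu≢s = sym (trans (*-congˡ (trans (*-congˡ (⟦⟧-off tu≢s)) (zeroʳ (b u)))) (zeroʳ (a t)))

    ⋆-kernelʳ : (a ⋆ b) s ≈ Σ[ (λ t → a t * Σ[ (λ u → b u * ⟦ t · u ⟧ s) ]) ]
    ⋆-kernelʳ = trans ⋆-kernel (Σ-cong (λ t → sym (*-distribˡ-Σ (a t) (λ u → b u * ⟦ t · u ⟧ s))))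

    ⋆-kernelˡ : (a ⋆ b) s ≈ Σ[ (λ u → b u * Σ[ (λ t → a t * ⟦ t · u ⟧ s) ]) ]
    ⋆-kernelˡ = trans ⋆-kernel (trans (Σ-comm (λ t u → a t * (b u * ⟦ t · u ⟧ s))) (Σ-cong λ u →
      trans (Σ-cong (λ t → x∙yz≈y∙xz (a t) (b u) (⟦ t · u ⟧ s)))
            (sym (*-distribˡ-Σ (b u) (λ t → a t * ⟦ t · u ⟧ s)))))

  record IsLinear (F : kS → kS) : Set (c ⊔ ℓ) where
    field
      cong   : ∀ {a b} → a ≈S b → F a ≈S F b
      +-homo : ∀ a b → F (a +S b) ≈S (F a +S F b)
      •-homo : ∀ r a → F (r • a) ≈S (r • F a)

    0-homo : F 0S ≈S 0S
    0-homo = ≈S-trans (cong (λ _ → sym (zeroˡ 0#))) (≈S-trans (•-homo 0# 0S) (•-zeroˡ (F 0S) refl))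

    -S-homo : ∀ a b → F (a -S b) ≈S (F a -S F b)
    -S-homo a b = ≈S-trans (+-homo a (-S b)) (λ s → +-congˡ (neg-homo s))
      where
      neg-homo : F (-S b) ≈S (-S F b)
      neg-homo = ≈S-trans (cong (λ s → sym (-1*x≈-x (b s))))
                          (≈S-trans (•-homo (- 1#) b) (λ s → -1*x≈-x (F b s)))

    ΣS-homo : ∀ {m} (f : Fin m → kS) → F (ΣS f) ≈S ΣS (F ∘ f)
    ΣS-homo {zero}  f = 0-homo
    ΣS-homo {suc m} f =
      ≈S-trans (+-homo (f zero) (ΣS (f ∘ suc))) (λ s → +-congˡ (ΣS-homo (f ∘ suc) s))

    when-homo : ∀ {p} {P : Set p} (P? : Dec P) a → F (when P? a) ≈S when P? (F a)
    when-homo (yes _) a = ≈S-refl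
    when-homo (no  _) a = 0-homo

    expand : ∀ a → F a ≈S ΣS (λ t → a t • F ⟦ t ⟧)
    expand a = ≈S-trans (cong (basis-expansion a))
      (≈S-trans (ΣS-homo (λ t → a t • ⟦ t ⟧)) (ΣS-cong (λ t → •-homo (a t) ⟦ t ⟧)))

  open IsLinear public

  linear-ext : ∀ {F G} → IsLinear F → IsLinear G → (∀ t → F ⟦ t ⟧ ≈S G ⟦ t ⟧) → ∀ a → F a ≈S G a
  linear-ext F-lin G-lin F≈G a = ≈S-trans (expand F-lin a)
    (≈S-trans (ΣS-cong (λ t → •-congˡ (a t) (F≈G t))) (≈S-sym (expand G-lin a)))

  ∘-linear : ∀ {F G} → IsLinear F → IsLinear G → IsLinear (F ∘ G)
  ∘-linear F-lin G-lin = record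
    { cong   = cong F-lin ∘ cong G-lin
    ; +-homo = λ a b → ≈S-trans (cong F-lin (+-homo G-lin a b)) (+-homo F-lin _ _)
    ; •-homo = λ r a → ≈S-trans (cong F-lin (•-homo G-lin r a)) (•-homo F-lin r _)
    }

  id-linear : IsLinear (λ a → a)
  id-linear = record { cong = λ a≈b → a≈b ; +-homo = λ _ _ → ≈S-refl ; •-homo = λ _ _ → ≈S-refl }

  kernel⇒linear : ∀ {F} (M : Fin n → Fin n → Carrier) →
                  (∀ a s → F a s ≈ Σ[ (λ t → a t * M s t) ]) → IsLinear F
  kernel⇒linear {F} M F≈M = record
    { cong   = λ {a} {b} a≈b s →
        trans (F≈M a s) (trans (Σ-cong (λ t → *-congʳ (a≈b t))) (sym (F≈M b s)))
    ; +-homo = λ a b s → begin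
        F (a +S b) s
          ≈⟨ F≈M (a +S b) s ⟩
        Σ[ (λ t → (a t + b t) * M s t) ]
          ≈⟨ Σ-cong (λ t → distribʳ (M s t) (a t) (b t)) ⟩
        Σ[ (λ t → a t * M s t + b t * M s t) ]
          ≈⟨ Σ-distrib-+ (λ t → a t * M s t) (λ t → b t * M s t) ⟩
        Σ[ (λ t → a t * M s t) ] + Σ[ (λ t → b t * M s t) ]
          ≈⟨ +-cong (F≈M a s) (F≈M b s) ⟨
        F a s + F b s
          ∎
    ; •-homo = λ r a s → begin
        F (r • a) s                     ≈⟨ F≈M (r • a) s ⟩
        Σ[ (λ t → (r * a t) * M s t) ]  ≈⟨ Σ-cong (λ t → *-assoc r (a t) (M s t)) ⟩
        Σ[ (λ t → r * (a t * M s t)) ]  ≈⟨ *-distribˡ-Σ r (λ t → a t * M s t) ⟨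
        r * Σ[ (λ t → a t * M s t) ]    ≈⟨ *-congˡ (F≈M a s) ⟨
        r * F a s                       ∎
    }
    where open SetoidReasoning setoid

  ⋆-linearʳ : ∀ b → IsLinear (_⋆ b)
  ⋆-linearʳ b = kernel⇒linear (λ s t → Σ[ (λ u → b u * ⟦ t · u ⟧ s) ]) (λ a → ⋆-kernelʳ a b)

  ⋆-linearˡ : ∀ a → IsLinear (a ⋆_)
  ⋆-linearˡ a = kernel⇒linear (λ s u → Σ[ (λ t → a t * ⟦ t · u ⟧ s) ]) (λ b → ⋆-kernelˡ a b)

  ⋆-congˡ : ∀ a {b b′} → b ≈S b′ → (a ⋆ b) ≈S (a ⋆ b′)
  ⋆-congˡ a = cong (⋆-linearˡ a)

  ⋆-congʳ : ∀ b {a a′} → a ≈S a′ → (a ⋆ b) ≈S (a′ ⋆ b)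
  ⋆-congʳ b = cong (⋆-linearʳ b)

  ⟦⟧⋆⟦⟧ : ∀ x y → (⟦ x ⟧ ⋆ ⟦ y ⟧) ≈S ⟦ x · y ⟧
  ⟦⟧⋆⟦⟧ x y s = trans (⋆-kernelʳ ⟦ x ⟧ ⟦ y ⟧ s)
    (trans (Σ-siftˡ x (λ t → Σ[ (λ u → ⟦ y ⟧ u * ⟦ t · u ⟧ s) ])) (Σ-siftˡ y (λ u → ⟦ x · u ⟧ s)))

  ⟦⟧⋆⟦⟧-below : ∀ {w x} → x ⊑ w → (⟦ w ⟧ ⋆ ⟦ x ⟧) ≈S ⟦ w ⟧
  ⟦⟧⋆⟦⟧-below {w} {x} x⊑w = ≈S-trans (⟦⟧⋆⟦⟧ w x) (≈S-reflexive (≡.cong ⟦_⟧ x⊑w))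

  ⋆-assoc : ∀ a b d → ((a ⋆ b) ⋆ d) ≈S (a ⋆ (b ⋆ d))
  ⋆-assoc a b d = linear-ext (∘-linear (⋆-linearʳ d) (⋆-linearʳ b)) (⋆-linearʳ (b ⋆ d)) on-basis a
    where
    on-basis³ : ∀ x y w → ((⟦ x ⟧ ⋆ ⟦ y ⟧) ⋆ ⟦ w ⟧) ≈S (⟦ x ⟧ ⋆ (⟦ y ⟧ ⋆ ⟦ w ⟧))
    on-basis³ x y w = begin
      (⟦ x ⟧ ⋆ ⟦ y ⟧) ⋆ ⟦ w ⟧  ≈⟨ ⋆-congʳ ⟦ w ⟧ (⟦⟧⋆⟦⟧ x y) ⟩
      ⟦ x · y ⟧ ⋆ ⟦ w ⟧        ≈⟨ ⟦⟧⋆⟦⟧ (x · y) w ⟩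
      ⟦ (x · y) · w ⟧          ≡⟨ ≡.cong ⟦_⟧ (·-assoc x y w) ⟩
      ⟦ x · (y · w) ⟧          ≈⟨ ⟦⟧⋆⟦⟧ x (y · w) ⟨
      ⟦ x ⟧ ⋆ ⟦ y · w ⟧        ≈⟨ ⋆-congˡ ⟦ x ⟧ (⟦⟧⋆⟦⟧ y w) ⟨
      ⟦ x ⟧ ⋆ (⟦ y ⟧ ⋆ ⟦ w ⟧)  ∎
      where open SetoidReasoning kS-setoid

    on-basis² : ∀ x y → ((⟦ x ⟧ ⋆ ⟦ y ⟧) ⋆ d) ≈S (⟦ x ⟧ ⋆ (⟦ y ⟧ ⋆ d))
    on-basis² x y = linear-ext (⋆-linearˡ (⟦ x ⟧ ⋆ ⟦ y ⟧))
      (∘-linear (⋆-linearˡ ⟦ x ⟧) (⋆-linearˡ ⟦ y ⟧)) (on-basis³ x y) d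

    on-basis : ∀ x → ((⟦ x ⟧ ⋆ b) ⋆ d) ≈S (⟦ x ⟧ ⋆ (b ⋆ d))
    on-basis x = linear-ext (∘-linear (⋆-linearʳ d) (⋆-linearˡ ⟦ x ⟧))
      (∘-linear (⋆-linearˡ ⟦ x ⟧) (⋆-linearʳ d)) (on-basis² x) b

  ⋆-identityˡ : ∀ a → (1S ⋆ a) ≈S a
  ⋆-identityˡ = linear-ext (⋆-linearˡ 1S) id-linear
    (λ t → ≈S-trans (⟦⟧⋆⟦⟧ one t) (≈S-reflexive (≡.cong ⟦_⟧ (one-l t))))

  ⋆-identityʳ : ∀ a → (a ⋆ 1S) ≈S a
  ⋆-identityʳ = linear-ext (⋆-linearʳ 1S) id-linear (λ t → ⟦⟧⋆⟦⟧-below (one-r t))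

  ⟦⟧⋆-support : ∀ {x t} b → ¬ x ⊑ t → (⟦ x ⟧ ⋆ b) t ≈ 0#
  ⟦⟧⋆-support {x} {t} b x⋢t = trans (expand (⋆-linearˡ ⟦ x ⟧) b t) (Σ-zero summand)
    where
    xu≢t : ∀ u → x · u ≢ t
    xu≢t u xu≡t = x⋢t (≡.subst (x ⊑_) xu≡t (⊑-·ˡ x u))
    summand : ∀ u → b u * (⟦ x ⟧ ⋆ ⟦ u ⟧) t ≈ 0#
    summand u = trans (*-congˡ (trans (⟦⟧⋆⟦⟧ x u t) (⟦⟧-off (xu≢t u)))) (zeroʳ (b u))

  ⋆⟦⟧-fixes : ∀ {t} a → (∀ u → ¬ t ⊑ u → a u ≈ 0#) → (a ⋆ ⟦ t ⟧) ≈S a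
  ⋆⟦⟧-fixes {t} a a≈0 = ≈S-trans (expand (⋆-linearʳ ⟦ t ⟧) a)
    (≈S-trans (ΣS-cong summand) (≈S-sym (basis-expansion a)))
    where
    summand : ∀ u → (a u • (⟦ u ⟧ ⋆ ⟦ t ⟧)) ≈S (a u • ⟦ u ⟧)
    summand u with _⪯?_ S t u
    ... | yes t⊑u = •-congˡ (a u) (⟦⟧⋆⟦⟧-below t⊑u)
    ... | no  t⋢u = ≈S-trans (•-zeroˡ _ (a≈0 u t⋢u)) (≈S-sym (•-zeroˡ _ (a≈0 u t⋢u)))

  Σ⟨_⟩ : ∀ {p} {P : Pred (Fin n) p} → Decidable P → (Fin n → kS) → kS
  Σ⟨ P? ⟩ f = ΣS (λ y → when (P? y) (f y))

  module _ {p q} {P : Pred (Fin n) p} {Q : Pred (Fin n) q} (P? : Decidable P) (Q? : Decidable Q) where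

    Σ⟨⟩-resp : ∀ {f g} → (∀ y → P y → Q y → f y ≈S g y) → (∀ y → P y → ¬ Q y → f y ≈S 0S) →
               (∀ y → ¬ P y → Q y → g y ≈S 0S) → Σ⟨ P? ⟩ f ≈S Σ⟨ Q? ⟩ g
    Σ⟨⟩-resp {f} {g} f≈g f≈0 g≈0 = ΣS-cong summand
      where
      summand : ∀ y → when (P? y) (f y) ≈S when (Q? y) (g y)
      summand y with P? y | Q? y
      ... | yes py | yes qy = f≈g y py qy
      ... | yes py | no ¬qy = f≈0 y py ¬qy
      ... | no ¬py | yes qy = ≈S-sym (g≈0 y ¬py qy)
      ... | no  _  | no  _  = ≈S-refl

    Σ⟨⟩-split : ∀ {r} {R : Pred (Fin n) r} (R? : Decidable R) f →
                (∀ y → P y → Q y ⊎ R y) → (∀ y → Q y → P y) → (∀ y → R y → P y) →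
                (∀ y → Q y → ¬ R y) → Σ⟨ P? ⟩ f ≈S (Σ⟨ Q? ⟩ f +S Σ⟨ R? ⟩ f)
    Σ⟨⟩-split R? f P⇒Q⊎R Q⇒P R⇒P Q⇒¬R s = trans (Σ-cong summand)
      (Σ-distrib-+ (λ y → when (Q? y) (f y) s) (λ y → when (R? y) (f y) s))
      where
      summand : ∀ y → when (P? y) (f y) s ≈ when (Q? y) (f y) s + when (R? y) (f y) s
      summand y with P? y | Q? y | R? y
      ... | _      | yes qy | yes ry = contradiction ry (Q⇒¬R y qy)
      ... | yes _  | yes _  | no  _  = sym (+-identityʳ _)
      ... | yes _  | no  _  | yes _  = sym (+-identityˡ _)
      ... | yes py | no ¬qy | no ¬ry =
        contradiction (P⇒Q⊎R y py) λ { (inj₁ qy) → ¬qy qy ; (inj₂ ry) → ¬ry ry }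
      ... | no ¬py | yes qy | no  _  = contradiction (Q⇒P y qy) ¬py
      ... | no ¬py | no  _  | yes ry = contradiction (R⇒P y ry) ¬py
      ... | no  _  | no  _  | no  _  = sym (+-identityʳ 0#)

  module _ {p} {P : Pred (Fin n) p} (P? : Decidable P) where

    Σ⟨⟩-cong : ∀ {f g} → (∀ y → P y → f y ≈S g y) → Σ⟨ P? ⟩ f ≈S Σ⟨ P? ⟩ g
    Σ⟨⟩-cong f≈g = Σ⟨⟩-resp P? P? (λ y py _ → f≈g y py)
      (λ _ py ¬py → contradiction py ¬py) (λ _ ¬py py → contradiction py ¬py)

    Σ⟨⟩-empty : ∀ f → (∀ y → ¬ P y) → Σ⟨ P? ⟩ f ≈S 0S
    Σ⟨⟩-empty f ¬P = ΣS-zero summand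
      where
      summand : ∀ y → when (P? y) (f y) ≈S 0S
      summand y with P? y
      ... | yes py = contradiction py (¬P y)
      ... | no  _  = ≈S-refl

    Σ⟨⟩-homo : ∀ {F} → IsLinear F → ∀ f → F (Σ⟨ P? ⟩ f) ≈S Σ⟨ P? ⟩ (F ∘ f)
    Σ⟨⟩-homo F-lin f = ≈S-trans (ΣS-homo F-lin (λ y → when (P? y) (f y)))
      (ΣS-cong (λ y → when-homo F-lin (P? y) (f y)))

  Σ⟨≟⟩ : ∀ z f → Σ⟨ _≟ z ⟩ f ≈S f z
  Σ⟨≟⟩ z f s = trans (Σ-single z off) (diag (z ≟ z))
    where
    off : ∀ y → y ≢ z → when (y ≟ z) (f y) s ≈ 0#
    off y y≢z with y ≟ z
    ... | yes y≡z = contradiction y≡z y≢z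
    ... | no  _   = refl
    diag : (d : Dec (z ≡ z)) → when d (f z) s ≈ f z s
    diag (yes _)   = refl
    diag (no  z≢z) = contradiction ≡.refl z≢z

  linear-into-span : ∀ {F} → IsLinear F → ∀ v → (∀ t → Σ Carrier (λ α → F ⟦ t ⟧ ≈S (α • v))) →
                     ∀ a → Σ Carrier (λ α → F a ≈S (α • v))
  linear-into-span {F} F-lin v on-basis a = Σ[ (λ t → a t * α t) ] , (begin
    F a                         ≈⟨ expand F-lin a ⟩
    ΣS (λ t → a t • F ⟦ t ⟧)    ≈⟨ ΣS-cong (λ t → •-congˡ (a t) (proj₂ (on-basis t))) ⟩
    ΣS (λ t → a t • (α t • v))  ≈⟨ ΣS-cong (λ t → •-assoc (a t) (α t) v) ⟩
    ΣS (λ t → (a t * α t) • v)  ≈⟨ ΣS-• (λ t → a t * α t) v ⟩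
    Σ[ (λ t → a t * α t) ] • v  ∎)
    where
    open SetoidReasoning kS-setoid
    α : Fin n → Carrier
    α t = proj₁ (on-basis t)

  orthogonal-summand-absorbed : ∀ {e a b} → IsIdempotent a → Orthogonal a b → e ≈S (a +S b) →
                                ((e ⋆ a) ≈S a) × ((a ⋆ e) ≈S a)
  orthogonal-summand-absorbed {e} {a} {b} a-idem (ab≈0 , ba≈0) e≈a+b = e⋆a≈a , a⋆e≈a
    where
    open SetoidReasoning kS-setoid
    e⋆a≈a : (e ⋆ a) ≈S a
    e⋆a≈a = begin
      e ⋆ a               ≈⟨ ⋆-congʳ a e≈a+b ⟩
      (a +S b) ⋆ a        ≈⟨ +-homo (⋆-linearʳ a) a b ⟩
      (a ⋆ a) +S (b ⋆ a)  ≈⟨ (λ s → trans (+-cong (a-idem s) (ba≈0 s)) (+-identityʳ (a s))) ⟩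
      a                   ∎
    a⋆e≈a : (a ⋆ e) ≈S a
    a⋆e≈a = begin
      a ⋆ e               ≈⟨ ⋆-congˡ a e≈a+b ⟩
      a ⋆ (a +S b)        ≈⟨ +-homo (⋆-linearˡ a) a b ⟩
      (a ⋆ a) +S (a ⋆ b)  ≈⟨ (λ s → trans (+-cong (a-idem s) (ab≈0 s)) (+-identityʳ (a s))) ⟩
      a                   ∎

  module _ (K-field : IsField K) where
    open IsField K-field

    •-cancel : ∀ {r a} → ¬ r ≈ 0# → (r • a) ≈S 0S → a ≈S 0S
    •-cancel {r} {a} r≉0 ra≈0 s = begin
      a s              ≈⟨ *-identityˡ (a s) ⟨
      1# * a s         ≈⟨ *-congʳ (trans (*-comm r⁻¹ r) (proj₂ (inverse r r≉0))) ⟨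
      (r⁻¹ * r) * a s  ≈⟨ *-assoc r⁻¹ r (a s) ⟩
      r⁻¹ * (r * a s)  ≈⟨ *-congˡ (ra≈0 s) ⟩
      r⁻¹ * 0#         ≈⟨ zeroʳ r⁻¹ ⟩
      0#               ∎
      where
      open SetoidReasoning setoid
      r⁻¹ : Carrier
      r⁻¹ = proj₁ (inverse r r≉0)

    -- For e = a + b orthogonal, a = e a e = α e with α ≠ 0, so α b = a b = 0 forces b = 0.
    corner-scalar⇒primitive : ∀ {e} → IsIdempotent e →
                              (∀ t → Σ Carrier (λ α → ((e ⋆ ⟦ t ⟧) ⋆ e) ≈S (α • e))) → IsPrimitive e
    corner-scalar⇒primitive {e} e-idem corner = e-idem , no-split
      where
      no-split : ¬ Σ kS (λ a → Σ kS (λ b → IsIdempotent a × IsIdempotent b × Orthogonal a b ×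
                                          ¬ (a ≈S 0S) × ¬ (b ≈S 0S) × (e ≈S (a +S b))))
      no-split (a , b , a-idem , b-idem , (ab≈0 , ba≈0) , a≉0 , b≉0 , e≈a+b) =
        b≉0 (•-cancel (λ α≈0 → a≉0 (≈S-trans a≈αe (•-zeroˡ e α≈0))) αb≈0)
        where
        open SetoidReasoning kS-setoid
        a-absorbed : ((e ⋆ a) ≈S a) × ((a ⋆ e) ≈S a)
        a-absorbed = orthogonal-summand-absorbed a-idem (ab≈0 , ba≈0) e≈a+b
        b-absorbed : ((e ⋆ b) ≈S b) × ((b ⋆ e) ≈S b)
        b-absorbed = orthogonal-summand-absorbed b-idem (ba≈0 , ab≈0) (λ s → trans (e≈a+b s) (+-comm (a s) (b s)))
        corner-a : Σ Carrier (λ α → ((e ⋆ a) ⋆ e) ≈S (α • e))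
        corner-a = linear-into-span (∘-linear (⋆-linearʳ e) (⋆-linearˡ e)) e corner a
        α : Carrier
        α = proj₁ corner-a
        a≈αe : a ≈S (α • e)
        a≈αe = begin
          a            ≈⟨ proj₂ a-absorbed ⟨
          a ⋆ e        ≈⟨ ⋆-congʳ e (proj₁ a-absorbed) ⟨
          (e ⋆ a) ⋆ e  ≈⟨ proj₂ corner-a ⟩
          α • e        ∎
        αb≈0 : (α • b) ≈S 0S
        αb≈0 = begin
          α • b        ≈⟨ •-congˡ α (proj₁ b-absorbed) ⟨
          α • (e ⋆ b)  ≈⟨ •-homo (⋆-linearʳ b) α e ⟨
          (α • e) ⋆ b  ≈⟨ ⋆-congʳ b a≈αe ⟨
          a ⋆ b        ≈⟨ ab≈0 ⟩
          0S           ∎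

module Idempotents {c ℓ : Level} (K : CommutativeRing c ℓ) (S : FiniteLRBMonoid) (C : SuppChoice S) where
  open CommutativeRing K hiding (zero)
  open FiniteLRBMonoid S
  open Algebra K S
  open SupportOrder S
  open MonoidAlgebra K S
  open SuppChoice C

  rep-isRep : ∀ s → IsRep C (rep s)
  rep-isRep s = rep-cong (rep s) s (rep-supp s)

  rep-unique : ∀ {x y} → IsRep C x → IsRep C y → x ⊑ y → y ⊑ x → x ≡ y
  rep-unique {x} {y} x∈L y∈L x⊑y y⊑x =
    ≡.trans (≡.sym x∈L) (≡.trans (rep-cong x y (x⊑y , y⊑x)) y∈L)

  above? : ∀ x → Decidable (λ y → IsRep C y × x ⊏ y)
  above? x y = isRep? C y ×-dec _≺?_ S x y

  atLeast? : ∀ w → Decidable (λ y → IsRep C y × w ⊑ y)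
  atLeast? w y = isRep? C y ×-dec _⪯?_ S w y

  -- Round k of the recursion is exact at x once k bounds the strict chains above x, as height x does.
  eFuel-stable : ∀ k x → height x ≤ k → eFuel C k x ≈S eFuel C (suc k) x
  eFuel-stable zero x hx≤0 = ≈S-sym (≈S-trans (-S-congˡ ⟦ x ⟧ (Σ⟨⟩-empty (above? x) _ nothing-above))
                                              (-S-identityʳ ⟦ x ⟧))
    where
    nothing-above : ∀ y → ¬ (IsRep C y × x ⊏ y)
    nothing-above y (_ , x⊏y) = n≮0 (<-≤-trans (height-< x⊏y) hx≤0)
  eFuel-stable (suc k) x hx≤1+k = -S-congˡ ⟦ x ⟧ (Σ⟨⟩-cong (above? x) (λ y (_ , x⊏y) →
    ⋆-congˡ ⟦ x ⟧ (eFuel-stable k y (≤-pred (<-≤-trans (height-< x⊏y) hx≤1+k)))))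

  e-unfold : ∀ x → e C x ≈S (⟦ x ⟧ -S Σ⟨ above? x ⟩ (λ y → ⟦ x ⟧ ⋆ e C y))
  e-unfold x = -S-congˡ ⟦ x ⟧ (Σ⟨⟩-cong (above? x) (λ y _ →
    ⋆-congˡ ⟦ x ⟧ (eFuel-stable n y (height≤n y))))

  ⟦⟧⋆e-below : ∀ {w x} → x ⊑ w →
               (⟦ w ⟧ ⋆ e C x) ≈S (⟦ w ⟧ -S Σ⟨ above? x ⟩ (λ y → ⟦ w ⟧ ⋆ e C y))
  ⟦⟧⋆e-below {w} {x} x⊑w = begin
    ⟦ w ⟧ ⋆ e C x
      ≈⟨ ⋆-congˡ ⟦ w ⟧ (e-unfold x) ⟩
    ⟦ w ⟧ ⋆ (⟦ x ⟧ -S Σ⟨ above? x ⟩ (λ y → ⟦ x ⟧ ⋆ e C y))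
      ≈⟨ -S-homo (⋆-linearˡ ⟦ w ⟧) ⟦ x ⟧ _ ⟩
    (⟦ w ⟧ ⋆ ⟦ x ⟧) -S (⟦ w ⟧ ⋆ Σ⟨ above? x ⟩ (λ y → ⟦ x ⟧ ⋆ e C y))
      ≈⟨ -S-cong (⟦⟧⋆⟦⟧-below x⊑w) (Σ⟨⟩-homo (above? x) (⋆-linearˡ ⟦ w ⟧) _) ⟩
    ⟦ w ⟧ -S Σ⟨ above? x ⟩ (λ y → ⟦ w ⟧ ⋆ (⟦ x ⟧ ⋆ e C y))
      ≈⟨ -S-congˡ ⟦ w ⟧ (Σ⟨⟩-cong (above? x) (λ y _ →
           ≈S-trans (≈S-sym (⋆-assoc ⟦ w ⟧ ⟦ x ⟧ (e C y))) (⋆-congʳ (e C y) (⟦⟧⋆⟦⟧-below x⊑w)))) ⟩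
    ⟦ w ⟧ -S Σ⟨ above? x ⟩ (λ y → ⟦ w ⟧ ⋆ e C y)
      ∎
    where open SetoidReasoning kS-setoid

  ⟦⟧⋆e-absorb : ∀ x → (⟦ x ⟧ ⋆ e C x) ≈S e C x
  ⟦⟧⋆e-absorb x = ≈S-trans (⟦⟧⋆e-below (⊑-refl x)) (≈S-sym (e-unfold x))

  e-support : ∀ {x t} → ¬ x ⊑ t → e C x t ≈ 0#
  e-support {x} {t} x⋢t = trans (sym (⟦⟧⋆e-absorb x t)) (⟦⟧⋆-support (e C x) x⋢t)

  basis-decomposition : ∀ w → ⟦ w ⟧ ≈S Σ⟨ atLeast? w ⟩ (λ y → ⟦ w ⟧ ⋆ e C y)
  basis-decomposition w = begin
    ⟦ w ⟧                                 ≈⟨ -S-+S-cancel ⟦ w ⟧ A ⟩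
    (⟦ w ⟧ -S A) +S A                     ≈⟨ (λ s → +-congʳ (⟦⟧⋆e-below z⊑w s)) ⟨
    (⟦ w ⟧ ⋆ e C z) +S A                  ≈⟨ (λ s → +-congʳ (Σ⟨≟⟩ z (λ y → ⟦ w ⟧ ⋆ e C y) s)) ⟨
    Σ⟨ _≟ z ⟩ (λ y → ⟦ w ⟧ ⋆ e C y) +S A  ≈⟨ Σ⟨⟩-split (atLeast? w) (_≟ z) (above? z) _
                                               split z-atLeast above-atLeast z-not-above ⟨
    Σ⟨ atLeast? w ⟩ (λ y → ⟦ w ⟧ ⋆ e C y)  ∎
    where
    open SetoidReasoning kS-setoid
    z : Fin n
    z = rep w
    z⊑w : z ⊑ w
    z⊑w = proj₁ (rep-supp w)
    w⊑z : w ⊑ z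
    w⊑z = proj₂ (rep-supp w)
    A : kS
    A = Σ⟨ above? z ⟩ (λ y → ⟦ w ⟧ ⋆ e C y)
    split : ∀ y → IsRep C y × w ⊑ y → y ≡ z ⊎ IsRep C y × z ⊏ y
    split y (y∈L , w⊑y) with y ≟ z
    ... | yes y≡z = inj₁ y≡z
    ... | no  y≢z = inj₂ (y∈L , z⊑y , λ y⊑z → y≢z (rep-unique y∈L (rep-isRep w) y⊑z z⊑y))
      where
      z⊑y : z ⊑ y
      z⊑y = ⊑-trans z⊑w w⊑y
    z-atLeast : ∀ y → y ≡ z → IsRep C y × w ⊑ y
    z-atLeast y ≡.refl = rep-isRep w , w⊑z
    above-atLeast : ∀ y → IsRep C y × z ⊏ y → IsRep C y × w ⊑ y
    above-atLeast y (y∈L , z⊑y , _) = y∈L , ⊑-trans w⊑z z⊑y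
    z-not-above : ∀ y → y ≡ z → ¬ (IsRep C y × z ⊏ y)
    z-not-above y ≡.refl (_ , z⊏z) = ⊏-irrefl z⊏z

  -- Lemma 4.1 of the paper.  In the recursion for s e_x only the Y ≥ supp (s x) survive,
  -- by induction, and these recombine to s x by basis-decomposition.
  ⟦⟧⋆e-vanishes : ∀ x s → ¬ s ⊑ x → (⟦ s ⟧ ⋆ e C x) ≈S 0S
  ⟦⟧⋆e-vanishes = All.wfRec ⊏-noetherian ℓ Vanishes step
    where
    Vanishes : Pred (Fin n) ℓ
    Vanishes x = ∀ s → ¬ s ⊑ x → (⟦ s ⟧ ⋆ e C x) ≈S 0S

    step : ∀ x → WfRec (flip _⊏_) Vanishes x → Vanishes x
    step x ih s s⋢x = begin
      ⟦ s ⟧ ⋆ e C x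
        ≈⟨ ⋆-congˡ ⟦ s ⟧ (⟦⟧⋆e-absorb x) ⟨
      ⟦ s ⟧ ⋆ (⟦ x ⟧ ⋆ e C x)
        ≈⟨ ≈S-trans (≈S-sym (⋆-assoc ⟦ s ⟧ ⟦ x ⟧ (e C x))) (⋆-congʳ (e C x) (⟦⟧⋆⟦⟧ s x)) ⟩
      ⟦ s · x ⟧ ⋆ e C x
        ≈⟨ ⟦⟧⋆e-below (⊑-·ʳ s x) ⟩
      ⟦ s · x ⟧ -S Σ⟨ above? x ⟩ (λ y → ⟦ s · x ⟧ ⋆ e C y)
        ≈⟨ -S-congˡ ⟦ s · x ⟧
             (Σ⟨⟩-resp (above? x) (atLeast? (s · x)) (λ _ _ _ → ≈S-refl) vanish absurd) ⟩
      ⟦ s · x ⟧ -S Σ⟨ atLeast? (s · x) ⟩ (λ y → ⟦ s · x ⟧ ⋆ e C y)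
        ≈⟨ -S-congˡ ⟦ s · x ⟧ (basis-decomposition (s · x)) ⟨
      ⟦ s · x ⟧ -S ⟦ s · x ⟧
        ≈⟨ -S-inverseʳ ⟦ s · x ⟧ ⟩
      0S
        ∎
      where
      open SetoidReasoning kS-setoid
      vanish : ∀ y → IsRep C y × x ⊏ y → ¬ (IsRep C y × s · x ⊑ y) → (⟦ s · x ⟧ ⋆ e C y) ≈S 0S
      vanish y (y∈L , x⊏y) ¬atLeast = ih x⊏y (s · x) (λ sx⊑y → ¬atLeast (y∈L , sx⊑y))
      absurd : ∀ y → ¬ (IsRep C y × x ⊏ y) → IsRep C y × s · x ⊑ y → (⟦ s · x ⟧ ⋆ e C y) ≈S 0S
      absurd y ¬above (y∈L , sx⊑y) = contradiction (y∈L , ⊏-⊑-trans (⊏-· s⋢x) sx⊑y) ¬above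

  e-complete : Σ⟨ isRep? C ⟩ (e C) ≈S 1S
  e-complete = ≈S-sym (≈S-trans (basis-decomposition one)
    (Σ⟨⟩-resp (atLeast? one) (isRep? C) (λ y _ _ → ⋆-identityˡ (e C y))
              (λ _ (y∈L , _) y∉L → contradiction y∈L y∉L)
              (λ y ¬atLeast y∈L → contradiction (y∈L , one-r y) ¬atLeast)))

  e⋆e-vanishes : ∀ {x y} → ¬ x ⊑ y → (e C x ⋆ e C y) ≈S 0S
  e⋆e-vanishes {x} {y} x⋢y = ≈S-trans (expand (⋆-linearʳ (e C y)) (e C x)) (ΣS-zero summand)
    where
    summand : ∀ t → (e C x t • (⟦ t ⟧ ⋆ e C y)) ≈S 0S
    summand t with _⪯?_ S x t
    ... | yes x⊑t = ≈S-trans (•-congˡ (e C x t) (⟦⟧⋆e-vanishes y t t⋢y)) (•-zeroʳ (e C x t))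
      where
      t⋢y : ¬ t ⊑ y
      t⋢y t⊑y = x⋢y (⊑-trans x⊑t t⊑y)
    ... | no  x⋢t = •-zeroˡ _ (e-support x⋢t)

  OrthogonalIdempotent : Fin n → Set ℓ
  OrthogonalIdempotent x = IsIdempotent (e C x) × (∀ y → IsRep C y → x ≢ y → (e C x ⋆ e C y) ≈S 0S)

  e-orthogonal-idempotent : ∀ x → IsRep C x → OrthogonalIdempotent x
  e-orthogonal-idempotent = All.wfRec ⊏-noetherian ℓ Claim step
    where
    Claim : Pred (Fin n) ℓ
    Claim x = IsRep C x → OrthogonalIdempotent x

    step : ∀ x → WfRec (flip _⊏_) Claim x → Claim x
    step x ih x∈L = idempotent , orthogonal
      where
      open SetoidReasoning kS-setoid

      orthogonal-above : ∀ y → IsRep C y → x ⊏ y → (e C x ⋆ e C y) ≈S 0S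
      orthogonal-above y y∈L x⊏y = begin
        e C x ⋆ e C y
          ≈⟨ ⋆-congʳ (e C y) (e-unfold x) ⟩
        (⟦ x ⟧ -S Σ⟨ above? x ⟩ (λ z → ⟦ x ⟧ ⋆ e C z)) ⋆ e C y
          ≈⟨ -S-homo (⋆-linearʳ (e C y)) ⟦ x ⟧ _ ⟩
        (⟦ x ⟧ ⋆ e C y) -S (Σ⟨ above? x ⟩ (λ z → ⟦ x ⟧ ⋆ e C z) ⋆ e C y)
          ≈⟨ -S-congˡ (⟦ x ⟧ ⋆ e C y) (Σ⟨⟩-homo (above? x) (⋆-linearʳ (e C y)) _) ⟩
        (⟦ x ⟧ ⋆ e C y) -S Σ⟨ above? x ⟩ (λ z → (⟦ x ⟧ ⋆ e C z) ⋆ e C y)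
          ≈⟨ -S-congˡ (⟦ x ⟧ ⋆ e C y) (Σ⟨⟩-resp (above? x) (_≟ y) hit miss absurd) ⟩
        (⟦ x ⟧ ⋆ e C y) -S Σ⟨ _≟ y ⟩ (λ _ → ⟦ x ⟧ ⋆ e C y)
          ≈⟨ -S-congˡ (⟦ x ⟧ ⋆ e C y) (Σ⟨≟⟩ y _) ⟩
        (⟦ x ⟧ ⋆ e C y) -S (⟦ x ⟧ ⋆ e C y)
          ≈⟨ -S-inverseʳ (⟦ x ⟧ ⋆ e C y) ⟩
        0S
          ∎
        where
        hit : ∀ z → IsRep C z × x ⊏ z → z ≡ y → ((⟦ x ⟧ ⋆ e C z) ⋆ e C y) ≈S (⟦ x ⟧ ⋆ e C y)
        hit z _ ≡.refl =
          ≈S-trans (⋆-assoc ⟦ x ⟧ (e C y) (e C y)) (⋆-congˡ ⟦ x ⟧ (proj₁ (ih x⊏y y∈L)))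
        miss : ∀ z → IsRep C z × x ⊏ z → z ≢ y → ((⟦ x ⟧ ⋆ e C z) ⋆ e C y) ≈S 0S
        miss z (z∈L , x⊏z) z≢y = ≈S-trans (⋆-assoc ⟦ x ⟧ (e C z) (e C y))
          (≈S-trans (⋆-congˡ ⟦ x ⟧ (proj₂ (ih x⊏z z∈L) y y∈L z≢y)) (0-homo (⋆-linearˡ ⟦ x ⟧)))
        absurd : ∀ z → ¬ (IsRep C z × x ⊏ z) → z ≡ y → (⟦ x ⟧ ⋆ e C y) ≈S 0S
        absurd z ¬above ≡.refl = contradiction (y∈L , x⊏y) ¬above

      orthogonal : ∀ y → IsRep C y → x ≢ y → (e C x ⋆ e C y) ≈S 0S
      orthogonal y y∈L x≢y with _⪯?_ S x y
      ... | no  x⋢y = e⋆e-vanishes x⋢y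
      ... | yes x⊑y = orthogonal-above y y∈L (x⊑y , λ y⊑x → x≢y (rep-unique x∈L y∈L x⊑y y⊑x))

      idempotent : IsIdempotent (e C x)
      idempotent = ≈S-sym (begin
        e C x                                ≈⟨ ⋆-identityʳ (e C x) ⟨
        e C x ⋆ 1S                           ≈⟨ ⋆-congˡ (e C x) e-complete ⟨
        e C x ⋆ Σ⟨ isRep? C ⟩ (e C)          ≈⟨ Σ⟨⟩-homo (isRep? C) (⋆-linearˡ (e C x)) (e C) ⟩
        Σ⟨ isRep? C ⟩ (λ y → e C x ⋆ e C y)  ≈⟨ Σ⟨⟩-resp (isRep? C) (_≟ x) (λ _ _ _ → ≈S-refl)
                                                  (λ y y∈L y≢x → orthogonal y y∈L (y≢x ∘ ≡.sym))
                                                  (λ { _ y∉L ≡.refl → contradiction x∈L y∉L }) ⟩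
        Σ⟨ _≟ x ⟩ (λ y → e C x ⋆ e C y)      ≈⟨ Σ⟨≟⟩ x _ ⟩
        e C x ⋆ e C x                        ∎)

  e-corner : ∀ {x} → IsRep C x → ∀ t → Σ Carrier (λ α → ((e C x ⋆ ⟦ t ⟧) ⋆ e C x) ≈S (α • e C x))
  e-corner {x} x∈L t with _⪯?_ S t x
  ... | yes t⊑x = 1# , (begin
    (e C x ⋆ ⟦ t ⟧) ⋆ e C x  ≈⟨ ⋆-congʳ (e C x) (⋆⟦⟧-fixes (e C x) vanishes-off-above-t) ⟩
    e C x ⋆ e C x            ≈⟨ proj₁ (e-orthogonal-idempotent x x∈L) ⟩
    e C x                    ≈⟨ •-identityˡ (e C x) ⟨
    1# • e C x               ∎)
    where
    open SetoidReasoning kS-setoid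
    vanishes-off-above-t : ∀ u → ¬ t ⊑ u → e C x u ≈ 0#
    vanishes-off-above-t u t⋢u = e-support (λ x⊑u → t⋢u (⊑-trans t⊑x x⊑u))
  ... | no  t⋢x = 0# , (begin
    (e C x ⋆ ⟦ t ⟧) ⋆ e C x  ≈⟨ ⋆-assoc (e C x) ⟦ t ⟧ (e C x) ⟩
    e C x ⋆ (⟦ t ⟧ ⋆ e C x)  ≈⟨ ⋆-congˡ (e C x) (⟦⟧⋆e-vanishes x t t⋢x) ⟩
    e C x ⋆ 0S               ≈⟨ 0-homo (⋆-linearˡ (e C x)) ⟩
    0S                       ≈⟨ •-zeroˡ (e C x) refl ⟨
    0# • e C x               ∎)
    where open SetoidReasoning kS-setoid

theorem4p2 : ∀ {c ℓ : Level} (K : CommutativeRing c ℓ) → IsField K →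
    (S : FiniteLRBMonoid) (C : SuppChoice S) →
    let open FiniteLRBMonoid S using (n)
        open Algebra K S
    in (∀ (x : Fin n) → IsRep C x → IsPrimitive (e C x))
       × (∀ (x y : Fin n) → IsRep C x → IsRep C y → x ≢ y → Orthogonal (e C x) (e C y))
       × (ΣS (λ x → when (isRep? C x) (e C x)) ≈S 1S)
theorem4p2 K K-field S C =
    (λ x x∈L → corner-scalar⇒primitive K-field (idempotent x∈L) (e-corner x∈L))
  , (λ x y x∈L y∈L x≢y → orthogonal x∈L y∈L x≢y , orthogonal y∈L x∈L (x≢y ∘ ≡.sym))
  , e-complete
  where
  open Algebra K S
  open MonoidAlgebra K S
  open Idempotents K S C

  idempotent : ∀ {x} → IsRep C x → IsIdempotent (e C x)
  idempotent {x} x∈L = proj₁ (e-orthogonal-idempotent x x∈L)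

  orthogonal : ∀ {x y} → IsRep C x → IsRep C y → x ≢ y → (e C x ⋆ e C y) ≈S 0S
  orthogonal {x} x∈L y∈L x≢y = proj₂ (e-orthogonal-idempotent x x∈L) _ y∈L x≢y
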